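{- Let $G$ be a deterministic parity game, i.e. every node $v$ of $G$ has exactly one successor ($|v.E|=1$). Then $\mathtt{psolB}$ completely solves $G$, i.e. $\mathtt{psolB}(G)$ is the empty game.
   Context: A parity game is a tuple $G=(V,V_0,V_1,E,c)$ where $V$ is a finite set of nodes partitioned into $V_0,V_1$, $E\subseteq V\times V$ with every node having a successor, and $c\colon V\to\mathbb{N}$. Let $v.E=\{w\mid(v,w)\in E\}$. For $U\subseteq V$, $G\setminus U$ is the game restricted to $V\setminus U$. $\mathrm{Attr}_p(G,X)$ is the least fixed point of $Z\mapsto X\cup\{v\in V_p\mid v.E\cap Z\ne\emptyset\}\cup\{v\in V_{1-p}\mid v.E\subseteq Z\}$. Let $\mathrm{mpre}_p(A,X,d)=\{v\in V_p\mid c(v)\geq d \wedge v.E\cap(A\cup X)\neq\emptyset\}\cup\{v\in V_{1-p}\mid c(v)\geq d\wedge v.E\subseteq A\cup X\}$; for a nonempty set $X$ of nodes of common color $d$, $\mathrm{MAttr}(X)$ is the least fixed point of $Z\mapsto\mathrm{mpre}_{d\bmod 2}(Z,X,d)$ in the current game. Algorithm $\mathtt{psolB}(G)$: for each color $d$ of $G$ in descending order: let $X$ be the set of nodes of color $d$; repeat: if $X=\emptyset$ go to the next color; if $X\subseteq\mathrm{MAttr}(X)$, return $\mathtt{psolB}(G\setminus\mathrm{Attr}_{d\bmod 2}(G,\mathrm{MAttr}(X)))$; else set $X:=X\cap\mathrm{MAttr}(X)$. If all colors are processed, return $G$. -}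

module Defs where

open import Data.Nat using (ℕ; zero; suc; _≤_; _⊔_; _≡ᵇ_)
open import Data.Bool using (Bool; true; false; not; _∧_)
open import Data.Fin using (Fin)
open import Data.List using (foldr; map; allFin)
open import Data.Product using (Σ; _×_)
open import Data.Sum using (_⊎_)
open import Relation.Nullary using (¬_)
open import Relation.Binary.PropositionalEquality using (_≡_; _≢_)
open import Function.Bundles using (_⇔_)

Sub : ℕ → Set
Sub n = Fin n → Bool

_∈_ : ∀ {n} → Fin n → Sub n → Set
v ∈ S = S v ≡ true

-- Players are Booleans: false = player 0, true = player 1.
-- par d = d mod 2 as a player.
par : ℕ → Bool
par zero = false
par (suc d) = not (par d)

-- A (sub)game on the universe Fin n.  Its nodes are those v with v ∈ V;
-- its edges are the pairs (v,w) of nodes with E v w ≡ true;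
-- V₁ = {v ∈ V | owner v ≡ true}, V₀ = {v ∈ V | owner v ≡ false}; colour c = col.
record Game (n : ℕ) : Set where
  field
    V     : Sub n
    E     : Fin n → Fin n → Bool
    owner : Fin n → Bool
    col   : Fin n → ℕ
open Game public

Succ : ∀ {n} → Game n → Fin n → Fin n → Set
Succ G v w = (w ∈ V G) × (E G v w ≡ true)

_∖_ : ∀ {n} → Game n → Sub n → Game n
G ∖ U = record G { V = λ v → V G v ∧ not (U v) }

data Attr {n} (G : Game n) (p : Bool) (X : Fin n → Set) : Fin n → Set where
  base : ∀ {v} → v ∈ V G → X v → Attr G p X v
  own  : ∀ {v} w → v ∈ V G → owner G v ≡ p → Succ G v w → Attr G p X w → Attr G p X v
  opp  : ∀ {v} → v ∈ V G → owner G v ≢ p →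
         (∀ w → Succ G v w → Attr G p X w) → Attr G p X v

-- MAttr(X) for X of colour d: least fixed point of Z ↦ mpre_{d mod 2}(Z, X, d)
data MAttr {n} (G : Game n) (d : ℕ) (X : Sub n) : Fin n → Set where
  own : ∀ {v} w → v ∈ V G → owner G v ≡ par d → d ≤ col G v →
        Succ G v w → (MAttr G d X w ⊎ w ∈ X) → MAttr G d X v
  opp : ∀ {v} → v ∈ V G → owner G v ≢ par d → d ≤ col G v →
        (∀ w → Succ G v w → MAttr G d X w ⊎ w ∈ X) → MAttr G d X v

colourSet : ∀ {n} → Game n → ℕ → Sub n
colourSet G d v = V G v ∧ (col G v ≡ᵇ d)

-- an upper bound of all colours (maximum over the whole universe); colours
-- not occurring in the current game are skipped by psolB since X = ∅ there.
maxCol : ∀ {n} → Game n → ℕ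
maxCol {n} G = foldr _⊔_ 0 (map (col G) (allFin n))

-- Big-step semantics of psolB:  PsolB G R  means  psolB(G) returns R.
--   Proc G m R : processing colours m-1, m-2, ..., 0 (descending) on G returns R.
--   Loop G d X R : the repeat-loop for colour d with current set X returns R.
data PsolB {n} : Game n → Game n → Set
data Proc {n} : Game n → ℕ → Game n → Set
data Loop {n} : Game n → ℕ → Sub n → Game n → Set

data PsolB {n} where
  run : ∀ {G R} → Proc G (suc (maxCol G)) R → PsolB G R

data Proc {n} where
  done : ∀ {G} → Proc G zero G
  next : ∀ {G d R} → Loop G d (colourSet G d) R → Proc G (suc d) R

data Loop {n} where
  empty  : ∀ {G d X R} → (∀ v → ¬ (v ∈ X)) → Proc G d R → Loop G d X R
  found  : ∀ {G d X R} v → v ∈ X →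
           (∀ w → w ∈ X → MAttr G d X w) →
           (A : Sub n) → (∀ w → (w ∈ A) ⇔ Attr G (par d) (MAttr G d X) w) →
           PsolB (G ∖ A) R → Loop G d X R
  shrink : ∀ {G d X R} v → v ∈ X →
           ¬ (∀ w → w ∈ X → MAttr G d X w) →
           (X' : Sub n) → (∀ w → (w ∈ X') ⇔ ((w ∈ X) × MAttr G d X w)) →
           Loop G d X' R → Loop G d X R

Deterministic : ∀ {n} → Game n → Set
Deterministic {n} G = ∀ v → v ∈ V G →
  Σ (Fin n) λ w → Succ G v w × (∀ u → Succ G v u → u ≡ w)

IsEmptyGame : ∀ {n} → Game n → Set
IsEmptyGame {n} G = ∀ (v : Fin n) → V G v ≡ false

-- In a deterministic game every node v has a unique successor  succ v,  so the
-- owner of a node is irrelevant and both attractors collapse to reachability: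
-- v ∈ Attr_p(P) iff the succ-path from v stays in the game until it meets P, and
-- v ∈ MAttr_d(X) iff it stays among nodes of colour ≥ d until its next step
-- enters X.  Such "until" predicates are decidable by Kleene iteration on the
-- finite powerset, which makes every test of psolB decidable; since the inner
-- loop shrinks X and every recursive call removes a nonempty attractor, a
-- well-founded recursion on sizes constructs a run of psolB (psolB-total).
--
-- For the result, note that every orbit of succ enters a cycle, and a node c of
-- minimal colour d on a cycle lies in MAttr_d(X) for every X containing c (a
-- "witness").  As long as the game is nonempty such a witness exists, and while
-- psolB descends through the colours the witness stays in the current X for
-- colour d, so the loop cannot exit through an empty X: every run ends with a
-- recursive call on a smaller deterministic game, until that game is empty
-- (psolB-empty).

module Submission where

open import Defs
open import Data.Nat using (ℕ; zero; suc; _+_; _*_; _≤_; _<_; _≤?_; _⊔_; z≤n; s≤s; NonZero)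
open import Data.Nat.Properties
  using (+-comm; ≤-refl; ≤-<-trans; <-≤-trans; <-irrefl; n<1+n; m≤n⇒∃[o]m+o≡n;
         m⊔n≤o⇒m≤o; m⊔n≤o⇒n≤o; ≡⇒≡ᵇ; m<1+n⇒m<n∨m≡n)
open import Data.Nat.DivMod using (_%_; _/_; m≡m%n+[m/n]*n; m%n<n)
open import Data.Nat.GeneralisedArithmetic using (fold; fold-+)
open import Data.Nat.Induction using (<-wellFounded)
open import Induction.WellFounded using (Acc; acc)
open import Data.Bool using (true; false)
open import Data.Bool.Properties using (T-≡; ¬-not) renaming (_≟_ to _≟ᵇ_)
open import Data.Fin using (Fin; toℕ)
open import Data.Fin.Properties using (any?; pigeonhole)
open import Data.Fin.Subset using (Subset; ∣_∣; ⊥)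
  renaming (_∈_ to _∈ˢ_; _⊆_ to _⊆ˢ_; _⊂_ to _⊂ˢ_)
open import Data.Fin.Subset.Properties using (_⊂?_; _∈?_; ⊥⊆; ∉⊥; p⊂q⇒∣p∣<∣q∣; ∣p∣≤n)
open import Data.Vec using (tabulate)
open import Data.Vec.Properties using (lookup∘tabulate; []=⇒lookup; lookup⇒[]=)
open import Data.List using (foldr; map; allFin; upTo)
open import Data.List.Properties using (foldr-forcesᵇ)
open import Data.List.Extrema.Nat using (argmin; f[argmin]≤f[xs])
open import Data.List.Relation.Unary.All as All using ()
open import Data.List.Membership.Propositional.Properties using (∈-map⁺; ∈-allFin; ∈-upTo⁺)
open import Data.Product using (Σ; ∃; ∃₂; _×_; _,_; proj₁; proj₂; map₂)
open import Data.Sum using (_⊎_; inj₁; inj₂)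
open import Relation.Nullary using (¬_; yes; no; does; contradiction)
open import Relation.Nullary.Decidable using (_×-dec_; _⊎-dec_; ¬?; map′; decidable-stable)
open import Relation.Unary using (Decidable)
open import Relation.Binary.PropositionalEquality
  using (_≡_; refl; sym; trans; cong; subst; module ≡-Reasoning)
open import Function using (_∘_)
open import Function.Bundles using (_⇔_; mk⇔; Equivalence)

open Equivalence using (to; from)
open ≡-Reasoning

⟦_⟧ : ∀ {n} {P : Fin n → Set} → Decidable P → Sub n
⟦ P? ⟧ v = does (P? v)

∈⟦⟧ : ∀ {n} {P : Fin n → Set} (P? : Decidable P) {v : Fin n} → v ∈ ⟦ P? ⟧ ⇔ P v
∈⟦⟧ P? {v} with P? v
... | yes p = mk⇔ (λ _ → p) (λ _ → refl)
... | no ¬p = mk⇔ (λ ()) (λ p → contradiction p ¬p)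

∈-∖ : ∀ {n} {G : Game n} {A : Sub n} {v : Fin n} → v ∈ V (G ∖ A) ⇔ (v ∈ V G × ¬ v ∈ A)
∈-∖ {G = G} {A} {v} with V G v | A v
... | true  | false = mk⇔ (λ _ → refl , λ ()) (λ _ → refl)
... | true  | true  = mk⇔ (λ ()) (λ (_ , v∉A) → contradiction refl v∉A)
... | false | _     = mk⇔ (λ ()) (λ ())

∈-tabulate : ∀ {n} (S : Sub n) {v : Fin n} → v ∈ˢ tabulate S ⇔ v ∈ S
∈-tabulate S {v} = mk⇔
  (λ v∈ → trans (sym (lookup∘tabulate S v)) ([]=⇒lookup v∈))
  (λ v∈ → lookup⇒[]= v (tabulate S) (trans (lookup∘tabulate S v) v∈))

size : ∀ {n} → Sub n → ℕ
size S = ∣ tabulate S ∣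

size-< : ∀ {n} {S T : Sub n} → (∀ {v} → v ∈ S → v ∈ T) →
         ∀ {v} → v ∈ T → ¬ v ∈ S → size S < size T
size-< {S = S} {T} S⊆T {v} v∈T v∉S = p⊂q⇒∣p∣<∣q∣
  ( (λ x∈S → from (∈-tabulate T) (S⊆T (to (∈-tabulate S) x∈S)))
  , v , from (∈-tabulate T) v∈T , v∉S ∘ to (∈-tabulate S))

⊆⇒⊂⊎⊇ : ∀ {n} {p q : Subset n} → p ⊆ˢ q → p ⊂ˢ q ⊎ q ⊆ˢ p
⊆⇒⊂⊎⊇ {p = p} {q} p⊆q with p ⊂? q
... | yes p⊂q = inj₁ p⊂q
... | no p⊄q = inj₂ λ {x} x∈q →
  decidable-stable (x ∈? p) (λ x∉p → p⊄q (p⊆q , x , x∈q , x∉p))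

-- Kleene iteration of a monotone operator on the subsets of Fin n reaches a
-- prefixed point after n+1 steps: each step either stabilises the chain or adds
-- an element, and there are only n elements.
module Kleene {n : ℕ} (F : Subset n → Subset n)
              (F-mono : ∀ {p q} → p ⊆ˢ q → F p ⊆ˢ F q) where

  iter : ℕ → Subset n
  iter zero    = ⊥
  iter (suc k) = F (iter k)

  iter-⊆-suc : ∀ k → iter k ⊆ˢ iter (suc k)
  iter-⊆-suc zero    = ⊥⊆
  iter-⊆-suc (suc k) = F-mono (iter-⊆-suc k)

  Stable : ℕ → Set
  Stable k = iter (suc k) ⊆ˢ iter k

  stable-or-growing : ∀ k → Stable k ⊎ k ≤ ∣ iter k ∣
  stable-or-growing zero = inj₂ z≤n
  stable-or-growing (suc k) with stable-or-growing k
  ... | inj₁ stable = inj₁ (F-mono stable)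
  ... | inj₂ k≤∣iter∣ with ⊆⇒⊂⊎⊇ (iter-⊆-suc k)
  ...   | inj₁ growing = inj₂ (≤-<-trans k≤∣iter∣ (p⊂q⇒∣p∣<∣q∣ growing))
  ...   | inj₂ stable  = inj₁ (F-mono stable)

  lfp : Subset n
  lfp = iter (suc n)

  lfp-closed : F lfp ⊆ˢ lfp
  lfp-closed with stable-or-growing (suc n)
  ... | inj₁ stable  = stable
  ... | inj₂ n<∣lfp∣ = contradiction (<-≤-trans n<∣lfp∣ (∣p∣≤n lfp)) (<-irrefl refl)

  lfp-induction : ∀ {P : Fin n → Set} →
    (∀ {p} → (∀ {v} → v ∈ˢ p → P v) → ∀ {v} → v ∈ˢ F p → P v) →
    ∀ {v} → v ∈ˢ lfp → P v
  lfp-induction {P} F-pres = iter-induction (suc n)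
    where
      iter-induction : ∀ k {v} → v ∈ˢ iter k → P v
      iter-induction zero    v∈⊥ = contradiction v∈⊥ ∉⊥
      iter-induction (suc k) = F-pres (iter-induction k)

module _ {n : ℕ} (s : Fin n → Fin n) (B Y : Fin n → Set) where

  data Until : Fin n → Set where
    here : ∀ {v} → B v → Y v → Until v
    step : ∀ {v} → B v → Until (s v) → Until v

  -- Until is the least fixed point of a monotone operator, hence decidable.
  until? : Decidable B → Decidable Y → Decidable Until
  until? B? Y? v = map′ sound complete (v ∈? lfp)
    where
      OneStep : Subset n → Fin n → Set
      OneStep p v = B v × (Y v ⊎ s v ∈ˢ p)

      oneStep? : ∀ p → Decidable (OneStep p)
      oneStep? p v = B? v ×-dec (Y? v ⊎-dec (s v ∈? p))

      F : Subset n → Subset n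
      F p = tabulate ⟦ oneStep? p ⟧

      ∈F : ∀ {p v} → v ∈ˢ F p ⇔ OneStep p v
      ∈F {p} = mk⇔ (to (∈⟦⟧ (oneStep? p)) ∘ to (∈-tabulate _))
                   (from (∈-tabulate _) ∘ from (∈⟦⟧ (oneStep? p)))

      F-mono : ∀ {p q} → p ⊆ˢ q → F p ⊆ˢ F q
      F-mono p⊆q v∈Fp with to ∈F v∈Fp
      ... | b , inj₁ y   = from ∈F (b , inj₁ y)
      ... | b , inj₂ s∈p = from ∈F (b , inj₂ (p⊆q s∈p))

      open Kleene F F-mono

      sound : ∀ {v} → v ∈ˢ lfp → Until v
      sound = lfp-induction λ p⊆Until v∈Fp → unfold (to ∈F v∈Fp) p⊆Until
        where
          unfold : ∀ {p v} → OneStep p v → (∀ {w} → w ∈ˢ p → Until w) → Until v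
          unfold (b , inj₁ y)   _       = here b y
          unfold (b , inj₂ s∈p) p⊆Until = step b (p⊆Until s∈p)

      complete : ∀ {v} → Until v → v ∈ˢ lfp
      complete (here b y) = lfp-closed (from ∈F (b , inj₁ y))
      complete (step b u) = lfp-closed (from ∈F (b , inj₂ (complete u)))

module _ {A : Set} (f : A → A) where

  fold-suc : ∀ x m → fold x f (suc m) ≡ fold (f x) f m
  fold-suc x m = trans (cong (fold x f) (+-comm 1 m)) (fold-+ x f m)

  fold-periodic : ∀ {u K} → fold u f K ≡ u → ∀ m → fold u f (m * K) ≡ u
  fold-periodic         cyc zero    = refl
  fold-periodic {u} {K} cyc (suc m) = begin
    fold u f (K + m * K)          ≡⟨ fold-+ u f K ⟩
    fold (fold u f (m * K)) f K   ≡⟨ cong (λ x → fold x f K) (fold-periodic cyc m) ⟩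
    fold u f K                    ≡⟨ cyc ⟩
    u                             ∎

  fold-mod : ∀ {u} K .{{_ : NonZero K}} → fold u f K ≡ u → ∀ j → fold u f j ≡ fold u f (j % K)
  fold-mod {u} K cyc j = begin
    fold u f j                                ≡⟨ cong (fold u f) (m≡m%n+[m/n]*n j K) ⟩
    fold u f (j % K + (j / K) * K)            ≡⟨ fold-+ u f (j % K) ⟩
    fold (fold u f ((j / K) * K)) f (j % K)   ≡⟨ cong (λ x → fold x f (j % K)) (fold-periodic cyc (j / K)) ⟩
    fold u f (j % K)                          ∎

  cycle-minimum : (g : A → ℕ) {u : A} (K : ℕ) .{{_ : NonZero K}} → fold u f K ≡ u →
    ∃ λ t → let c = fold u f t in fold c f K ≡ c × (∀ j → g c ≤ g (fold c f j))
  cycle-minimum g {u} K cyc = t , c-cycle , c-minimal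
    where
      weight : ℕ → ℕ
      weight j = g (fold u f j)

      t : ℕ
      t = argmin weight 0 (upTo K)

      t-minimal : ∀ i → i < K → weight t ≤ weight i
      t-minimal i i<K = All.lookup (f[argmin]≤f[xs] 0 (upTo K)) (∈-upTo⁺ i<K)

      shift : ∀ j → fold (fold u f t) f j ≡ fold u f (j + t)
      shift j = sym (fold-+ u f j)

      c-cycle : fold (fold u f t) f K ≡ fold u f t
      c-cycle = begin
        fold (fold u f t) f K   ≡⟨ shift K ⟩
        fold u f (K + t)        ≡⟨ cong (fold u f) (+-comm K t) ⟩
        fold u f (t + K)        ≡⟨ fold-+ u f t ⟩
        fold (fold u f K) f t   ≡⟨ cong (λ x → fold x f t) cyc ⟩
        fold u f t              ∎

      c-minimal : ∀ j → g (fold u f t) ≤ g (fold (fold u f t) f j)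
      c-minimal j rewrite shift j | fold-mod K cyc (j + t) = t-minimal _ (m%n<n (j + t) K)

orbit-cycle : ∀ {n} (f : Fin n → Fin n) (v : Fin n) →
  ∃₂ λ i k → fold (fold v f i) f (suc k) ≡ fold v f i
orbit-cycle {n} f v with pigeonhole (n<1+n n) (λ i → fold v f (toℕ i))
... | i , j , i<j , same with m≤n⇒∃[o]m+o≡n i<j
...   | k , i+k≡j = toℕ i , k , (begin
  fold (fold v f (toℕ i)) f (suc k)   ≡⟨ sym (fold-+ v f (suc k)) ⟩
  fold v f (suc k + toℕ i)            ≡⟨ cong (fold v f) (trans (cong suc (+-comm k (toℕ i))) i+k≡j) ⟩
  fold v f (toℕ j)                    ≡⟨ sym same ⟩
  fold v f (toℕ i)                    ∎)

-- A witness of colour d: a node of colour d lying in MAttr_d(X) for every X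
-- that contains it.  It keeps psolB from leaving colour d without a removal.
Witness : ∀ {n} → Game n → ℕ → Fin n → Set
Witness G d c = c ∈ V G × col G c ≡ d × (∀ X → c ∈ X → MAttr G d X c)

mattr-in-game : ∀ {n} {G : Game n} {d X v} → MAttr G d X v → v ∈ V G
mattr-in-game (own _ v∈V _ _ _ _) = v∈V
mattr-in-game (opp v∈V _ _ _)     = v∈V

module DeterministicGame {n : ℕ} (G : Game n) (det : Deterministic G) where

  -- The successor function, extended by the identity outside the game.
  choose : ∀ v → Σ (Fin n) λ w → v ∈ V G → Succ G v w × (∀ u → Succ G v u → u ≡ w)
  choose v with V G v in v∈V
  ... | true  = let (w , w∈vE , unique) = det v v∈V in w , λ _ → w∈vE , unique
  ... | false = v , λ ()

  succ : Fin n → Fin n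
  succ v = proj₁ (choose v)

  succ-Succ : ∀ {v} → v ∈ V G → Succ G v (succ v)
  succ-Succ {v} v∈V = proj₁ (proj₂ (choose v) v∈V)

  succ-unique : ∀ {v w} → v ∈ V G → Succ G v w → w ≡ succ v
  succ-unique {v} {w} v∈V w∈vE = proj₂ (proj₂ (choose v) v∈V) w w∈vE

  -- With a single move, the owner's and the opponent's rule both amount to
  -- "the successor is attracted".
  attr-step : ∀ {p P v} → v ∈ V G → Attr G p P (succ v) → Attr G p P v
  attr-step {p} {P} {v} v∈V a with owner G v ≟ᵇ p
  ... | yes mine   = own (succ v) v∈V mine (succ-Succ v∈V) a
  ... | no  theirs = opp v∈V theirs λ w w∈vE → subst (Attr G p P) (sym (succ-unique v∈V w∈vE)) a

  mattr-step : ∀ {d X v} → v ∈ V G → d ≤ col G v →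
               MAttr G d X (succ v) ⊎ succ v ∈ X → MAttr G d X v
  mattr-step {d} {X} {v} v∈V d≤c m with owner G v ≟ᵇ par d
  ... | yes mine   = own (succ v) v∈V mine d≤c (succ-Succ v∈V) m
  ... | no  theirs = opp v∈V theirs d≤c λ w w∈vE →
    subst (λ w → MAttr G d X w ⊎ w ∈ X) (sym (succ-unique v∈V w∈vE)) m

  InGame : Fin n → Set
  InGame v = v ∈ V G

  attr⇔until : ∀ {p P v} → Attr G p P v ⇔ Until succ InGame P v
  attr⇔until {p} {P} = mk⇔ attr→until until→attr
    where
      attr→until : ∀ {v} → Attr G p P v → Until succ InGame P v
      attr→until (base v∈V x)         = here v∈V x
      attr→until (own w v∈V _ w∈vE a) =
        step v∈V (subst (Until succ InGame P) (succ-unique v∈V w∈vE) (attr→until a))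
      attr→until (opp {v} v∈V _ all)  = step v∈V (attr→until (all (succ v) (succ-Succ v∈V)))

      until→attr : ∀ {v} → Until succ InGame P v → Attr G p P v
      until→attr (here v∈V x) = base v∈V x
      until→attr (step v∈V u) = attr-step v∈V (until→attr u)

  -- The nodes MAttr_d may pass through, and those whose next step enters X.
  Above : ℕ → Fin n → Set
  Above d v = v ∈ V G × d ≤ col G v

  Enters : Sub n → Fin n → Set
  Enters X v = succ v ∈ X

  mattr⇔until : ∀ {d X v} → MAttr G d X v ⇔ Until succ (Above d) (Enters X) v
  mattr⇔until {d} {X} = mk⇔ mattr→until until→mattr
    where
      mattr→until : ∀ {v} → MAttr G d X v → Until succ (Above d) (Enters X) v
      mattr→until (own w v∈V _ d≤c w∈vE (inj₁ m)) =
        step (v∈V , d≤c) (subst (Until succ (Above d) (Enters X)) (succ-unique v∈V w∈vE) (mattr→until m))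
      mattr→until (own w v∈V _ d≤c w∈vE (inj₂ x)) =
        here (v∈V , d≤c) (subst (_∈ X) (succ-unique v∈V w∈vE) x)
      mattr→until (opp {v} v∈V _ d≤c all) with all (succ v) (succ-Succ v∈V)
      ... | inj₁ m = step (v∈V , d≤c) (mattr→until m)
      ... | inj₂ x = here (v∈V , d≤c) x

      until→mattr : ∀ {v} → Until succ (Above d) (Enters X) v → MAttr G d X v
      until→mattr (here (v∈V , d≤c) x) = mattr-step v∈V d≤c (inj₂ x)
      until→mattr (step (v∈V , d≤c) u) = mattr-step v∈V d≤c (inj₁ (until→mattr u))

  inGame? : Decidable InGame
  inGame? v = V G v ≟ᵇ true

  attr? : ∀ p {P : Fin n → Set} → Decidable P → Decidable (Attr G p P)
  attr? p P? v = map′ (from attr⇔until) (to attr⇔until) (until? succ InGame _ inGame? P? v)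

  mattr? : ∀ d X → Decidable (MAttr G d X)
  mattr? d X v = map′ (from mattr⇔until) (to mattr⇔until)
    (until? succ (Above d) (Enters X) (λ w → inGame? w ×-dec (d ≤? col G w)) (λ w → X (succ w) ≟ᵇ true) v)

  deterministic-∖ : ∀ {A} → (∀ {v} → v ∈ V G → succ v ∈ A → v ∈ A) → Deterministic (G ∖ A)
  deterministic-∖ {A} closed v v∈G∖A =
    succ v , (from ∈G∖A (succ∈V , v∉A ∘ closed v∈V) , proj₂ (succ-Succ v∈V)) ,
    λ u (u∈G∖A , vu∈E) → succ-unique v∈V (proj₁ (to ∈G∖A u∈G∖A) , vu∈E)
    where
      ∈G∖A : ∀ {u} → u ∈ V (G ∖ A) ⇔ (u ∈ V G × ¬ u ∈ A)
      ∈G∖A = ∈-∖ {G = G} {A}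
      v∈V : v ∈ V G
      v∈V = proj₁ (to ∈G∖A v∈G∖A)
      v∉A : ¬ v ∈ A
      v∉A = proj₂ (to ∈G∖A v∈G∖A)
      succ∈V : succ v ∈ V G
      succ∈V = proj₁ (succ-Succ v∈V)

  attr-closed : ∀ {p P} (P? : Decidable P) {v} → v ∈ V G →
                succ v ∈ ⟦ attr? p P? ⟧ → v ∈ ⟦ attr? p P? ⟧
  attr-closed {p} P? v∈V a = from (∈⟦⟧ (attr? p P?)) (attr-step v∈V (to (∈⟦⟧ (attr? p P?)) a))

  succ^-V : ∀ k {v} → v ∈ V G → fold v succ k ∈ V G
  succ^-V zero    v∈V = v∈V
  succ^-V (suc k) v∈V = proj₁ (succ-Succ (succ^-V k v∈V))

  mattr-path : ∀ {d X} m {w} → w ∈ V G → (∀ j → d ≤ col G (fold w succ j)) →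
               fold w succ (suc m) ∈ X → MAttr G d X w
  mattr-path zero    w∈V above enters = mattr-step w∈V (above 0) (inj₂ enters)
  mattr-path {d} {X} (suc m) {w} w∈V above enters =
    mattr-step w∈V (above 0) (inj₁ (mattr-path m (proj₁ (succ-Succ w∈V)) above′ enters′))
    where
      above′ : ∀ j → d ≤ col G (fold (succ w) succ j)
      above′ j = subst (λ x → d ≤ col G x) (fold-suc succ w j) (above (suc j))
      enters′ : fold (succ w) succ (suc m) ∈ X
      enters′ = subst (_∈ X) (fold-suc succ w (suc m)) enters

  -- Every nonempty deterministic game has a witness: a minimal-colour node on
  -- the cycle that the orbit of any node runs into.
  witness : ∀ {v} → v ∈ V G → ∃₂ (Witness G)
  witness {v} v∈V = col G c , c , c∈V , refl , c-returns
    where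
      u : Fin n
      u = fold v succ (proj₁ (orbit-cycle succ v))
      k : ℕ
      k = proj₁ (proj₂ (orbit-cycle succ v))
      u-cycle : fold u succ (suc k) ≡ u
      u-cycle = proj₂ (proj₂ (orbit-cycle succ v))
      t : ℕ
      t = proj₁ (cycle-minimum succ (col G) (suc k) u-cycle)
      c : Fin n
      c = fold u succ t
      c-cycle : fold c succ (suc k) ≡ c
      c-cycle = proj₁ (proj₂ (cycle-minimum succ (col G) (suc k) u-cycle))
      c-minimal : ∀ j → col G c ≤ col G (fold c succ j)
      c-minimal = proj₂ (proj₂ (cycle-minimum succ (col G) (suc k) u-cycle))
      c∈V : c ∈ V G
      c∈V = succ^-V t (succ^-V (proj₁ (orbit-cycle succ v)) v∈V)
      c-returns : ∀ X → c ∈ X → MAttr G (col G c) X c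
      c-returns X c∈X = mattr-path k c∈V c-minimal (subst (_∈ X) (sym c-cycle) c∈X)

-- One run of psolB on a deterministic game, given runs on all smaller
-- deterministic subgames G ∖ A.
module Construction {n : ℕ} (G : Game n) (det : Deterministic G)
    (solve-smaller : ∀ A → size (V (G ∖ A)) < size (V G) → Deterministic (G ∖ A) →
                     Σ (Game n) (PsolB (G ∖ A))) where

  open DeterministicGame G det

  survives? : ∀ d X → Decidable (λ w → w ∈ X × MAttr G d X w)
  survives? d X w = (X w ≟ᵇ true) ×-dec mattr? d X w

  restrict : ℕ → Sub n → Sub n
  restrict d X = ⟦ survives? d X ⟧

  restrict-shrinks : ∀ {d X w} → w ∈ X → ¬ MAttr G d X w → size (restrict d X) < size X
  restrict-shrinks {d} {X} w∈X w∉M =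
    size-< {S = restrict d X} {T = X} (proj₁ ∘ to (∈⟦⟧ (survives? d X))) w∈X
           (w∉M ∘ proj₂ ∘ to (∈⟦⟧ (survives? d X)))

  attractor : ℕ → Sub n → Sub n
  attractor d X = ⟦ attr? (par d) (mattr? d X) ⟧

  attractor-removes : ∀ {d X v} → MAttr G d X v → size (V (G ∖ attractor d X)) < size (V G)
  attractor-removes {d} {X} {v} v∈M =
    size-< {S = V (G ∖ attractor d X)} {T = V G} (proj₁ ∘ to ∈G∖A) v∈V
           (λ v∈G∖A → proj₂ (to ∈G∖A v∈G∖A) (from (∈⟦⟧ (attr? (par d) (mattr? d X))) (base v∈V v∈M)))
    where
      ∈G∖A : ∀ {u} → u ∈ V (G ∖ attractor d X) ⇔ (u ∈ V G × ¬ u ∈ attractor d X)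
      ∈G∖A = ∈-∖ {G = G} {attractor d X}
      v∈V : v ∈ V G
      v∈V = mattr-in-game v∈M

  process : ∀ m → Σ (Game n) (Proc G m)
  loop : ∀ d X → Acc _<_ (size X) → Σ (Game n) (Loop G d X)

  process zero    = G , done
  process (suc d) = map₂ next (loop d (colourSet G d) (<-wellFounded _))

  loop d X (acc smaller)
    with any? (λ v → X v ≟ᵇ true) | any? (λ w → (X w ≟ᵇ true) ×-dec ¬? (mattr? d X w))
  ... | no X-empty    | _ = map₂ (empty (λ v v∈X → X-empty (v , v∈X))) (process d)
  ... | yes (v , v∈X) | no X⊆M =
    map₂ (found v v∈X X⊆MAttr (attractor d X) (λ _ → ∈⟦⟧ (attr? (par d) (mattr? d X))))
         (solve-smaller (attractor d X) (attractor-removes (X⊆MAttr v v∈X))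
                        (deterministic-∖ (attr-closed {p = par d} (mattr? d X))))
    where
      X⊆MAttr : ∀ w → w ∈ X → MAttr G d X w
      X⊆MAttr w w∈X = decidable-stable (mattr? d X w) (λ w∉M → X⊆M (w , w∈X , w∉M))
  ... | yes (v , v∈X) | yes (w , w∈X , w∉M) =
    map₂ (shrink v v∈X (λ X⊆M → w∉M (X⊆M w w∈X)) (restrict d X) (λ _ → ∈⟦⟧ (survives? d X)))
         (loop d (restrict d X) (smaller (restrict-shrinks w∈X w∉M)))

psolB-total : ∀ {n} (G : Game n) → Deterministic G → Acc _<_ (size (V G)) → Σ (Game n) (PsolB G)
psolB-total G det (acc smaller) =
  map₂ run (Construction.process G det (λ A removed det′ → psolB-total (G ∖ A) det′ (smaller removed))
                                 (suc (maxCol G)))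

-- maxCol bounds every colour, so a witness is reached by the descending loop.
col-≤-maxCol : ∀ {n} (G : Game n) v → col G v ≤ maxCol G
col-≤-maxCol {n} G v = All.lookup bounded (∈-map⁺ (col G) (∈-allFin v))
  where
    bounded : All.All (_≤ maxCol G) (map (col G) (allFin n))
    bounded = foldr-forcesᵇ {P = _≤ maxCol G} {f = _⊔_}
                (λ x y x⊔y≤ → m⊔n≤o⇒m≤o x y x⊔y≤ , m⊔n≤o⇒n≤o x y x⊔y≤)
                0 (map (col G) (allFin n)) ≤-refl

∈-colourSet : ∀ {n} {G : Game n} {c} → c ∈ V G → c ∈ colourSet G (col G c)
∈-colourSet {G = G} {c} c∈V rewrite c∈V = to T-≡ (≡⇒≡ᵇ (col G c) (col G c) refl)

module _ {n : ℕ} where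

  -- The invariant of a run: the current game is empty, or it has a witness
  -- whose colour is still to be processed (below m, resp. below d or equal to d
  -- and still in the current X).
  Pending : Game n → ℕ → Set
  Pending G m = IsEmptyGame G ⊎ ∃₂ λ d c → Witness G d c × d < m

  Awaits : ℕ → Sub n → ℕ → Fin n → Set
  Awaits d X d′ c = d′ < d ⊎ (d′ ≡ d × c ∈ X)

  PendingLoop : Game n → ℕ → Sub n → Set
  PendingLoop G d X = IsEmptyGame G ⊎ ∃₂ λ d′ c → Witness G d′ c × Awaits d X d′ c

  witness-below : ∀ {G : Game n} {d c} → Witness G d c → d < suc (maxCol G)
  witness-below {G} {c = c} (_ , refl , _) = s≤s (col-≤-maxCol G c)

  pending-start : ∀ {G : Game n} → Deterministic G → Pending G (suc (maxCol G))
  pending-start {G} det with any? (DeterministicGame.inGame? G det)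
  ... | no none       = inj₁ λ v → ¬-not λ v∈V → none (v , v∈V)
  ... | yes (_ , v∈V) = inj₂ (proj₁ wit , proj₁ (proj₂ wit) , proj₂ (proj₂ wit) ,
                              witness-below (proj₂ (proj₂ wit)))
    where
      wit : ∃₂ (Witness G)
      wit = DeterministicGame.witness G det v∈V

  -- Starting the loop for colour d: X is the colour class, so a witness of
  -- colour d is in it.
  pending-enter : ∀ {G : Game n} {d} → Pending G (suc d) → PendingLoop G d (colourSet G d)
  pending-enter (inj₁ G-empty) = inj₁ G-empty
  pending-enter {G} (inj₂ (d′ , c , c-wit@(c∈V , refl , _) , d′<1+d)) with m<1+n⇒m<n∨m≡n d′<1+d
  ... | inj₁ d′<d = inj₂ (d′ , c , c-wit , inj₁ d′<d)
  ... | inj₂ refl = inj₂ (d′ , c , c-wit , inj₂ (refl , ∈-colourSet {G = G} c∈V))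

  -- Leaving the loop with X empty is only possible if the witness has smaller colour.
  pending-exit : ∀ {G : Game n} {d X} → (∀ v → ¬ v ∈ X) → PendingLoop G d X → Pending G d
  pending-exit X-empty (inj₁ G-empty) = inj₁ G-empty
  pending-exit X-empty (inj₂ (d′ , c , c-wit , inj₁ d′<d)) = inj₂ (d′ , c , c-wit , d′<d)
  pending-exit X-empty (inj₂ (d′ , c , c-wit , inj₂ (refl , c∈X))) = contradiction c∈X (X-empty c)

  pending-shrink : ∀ {G : Game n} {d X X′} → (∀ w → w ∈ X′ ⇔ (w ∈ X × MAttr G d X w)) →
                   PendingLoop G d X → PendingLoop G d X′
  pending-shrink X′-def (inj₁ G-empty) = inj₁ G-empty
  pending-shrink X′-def (inj₂ (d′ , c , c-wit , inj₁ d′<d)) = inj₂ (d′ , c , c-wit , inj₁ d′<d)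
  pending-shrink {X = X} X′-def (inj₂ (d′ , c , c-wit@(_ , _ , c-returns) , inj₂ (refl , c∈X))) =
    inj₂ (d′ , c , c-wit , inj₂ (refl , from (X′-def c) (c∈X , c-returns X c∈X)))

  psolB-empty : ∀ {G R : Game n} → Deterministic G → PsolB G R → IsEmptyGame R
  proc-empty  : ∀ {G R : Game n} {m} → Deterministic G → Proc G m R → Pending G m → IsEmptyGame R
  loop-empty  : ∀ {G R : Game n} {d X} → Deterministic G → Loop G d X R → PendingLoop G d X →
                IsEmptyGame R

  psolB-empty det (run p) = proc-empty det p (pending-start det)

  proc-empty det done     (inj₁ G-empty)         = G-empty
  proc-empty det done     (inj₂ (_ , _ , _ , ()))
  proc-empty det (next l) pending                = loop-empty det l (pending-enter pending)

  loop-empty det (empty X-empty p)         pending = proc-empty det p (pending-exit X-empty pending)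
  loop-empty det (shrink _ _ _ _ X′-def l) pending = loop-empty det l (pending-shrink X′-def pending)
  loop-empty {G} det (found _ _ _ A A-def p) _     = psolB-empty (deterministic-∖ closed) p
    where
      open DeterministicGame G det
      closed : ∀ {v} → v ∈ V G → succ v ∈ A → v ∈ A
      closed {v} v∈V a = from (A-def v) (attr-step v∈V (to (A-def (succ v)) a))

lemma5 : ∀ (n : ℕ) (G : Game n) → Deterministic G →
    Σ (Game n) (λ R → PsolB G R) × (∀ R → PsolB G R → IsEmptyGame R)
lemma5 n G det = psolB-total G det (<-wellFounded (size (V G))) , λ R → psolB-empty det
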